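{- For every $n\ge 1$, ${\rm gp}_{\rm t}(S_3^n)={\rm gp}_{\rm d}(S_3^n)=3$. Moreover, $S_3^n$ has exactly one total general position set of cardinality $3$ and exactly one dual general position set of cardinality $3$.
   Context: The Sierpiński graph $S_3^n$ ($n\ge1$) has vertex set $\{0,1,2\}^n$ (vertices written as words $i_1\cdots i_n$), and $i_1\cdots i_n$ is adjacent to $j_1\cdots j_n$ iff there is $h\in\{1,\dots,n\}$ with $i_t=j_t$ for all $t<h$, $i_h\ne j_h$, and $i_t=j_h$, $j_t=i_h$ for all $t>h$. For a graph $G$ and $X\subseteq V(G)$, $u,v$ are $X$-positionable if every shortest $u,v$-path $P$ has $V(P)\cap X\subseteq\{u,v\}$. $X$ is a total general position set if every two vertices of $G$ are $X$-positionable; $X$ is a dual general position set if every two vertices of $X$ are $X$-positionable and every two vertices of $V(G)\setminus X$ are $X$-positionable. ${\rm gp}_{\rm t}(G)$, ${\rm gp}_{\rm d}(G)$ are the respective maximum sizes. -}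

module Defs where

open import Data.Nat using (ℕ; zero; suc; _≤_)
open import Data.Fin using (Fin) renaming (_<_ to _<ᶠ_)
open import Data.Vec using (Vec; lookup)
open import Data.List using (List; []; _∷_; length)
open import Data.List.Membership.Propositional using (_∈_; _∉_)
open import Data.List.Relation.Unary.Unique.Propositional using (Unique)
open import Data.Product using (Σ; _×_; _,_)
open import Data.Sum using (_⊎_)
open import Relation.Binary.PropositionalEquality using (_≡_; _≢_)
open import Function.Bundles using (_⇔_)

module Graph (V : Set) (Adj : V → V → Set) where

  data Walk : V → V → Set where
    nil  : ∀ {u} → Walk u u
    cons : ∀ {u w v} → Adj u w → Walk w v → Walk u v

  len : ∀ {u v} → Walk u v → ℕ
  len nil        = zero
  len (cons _ p) = suc (len p)

  verts : ∀ {u v} → Walk u v → List V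
  verts {u} nil        = u ∷ []
  verts {u} (cons _ p) = u ∷ verts p

  -- a shortest u,v-path: a u,v-walk of minimum length (necessarily a path)
  Shortest : ∀ {u v} → Walk u v → Set
  Shortest {u} {v} p = ∀ (q : Walk u v) → len p ≤ len q

  -- vertex sets are duplicate-free lists; membership is list membership
  Positionable : List V → V → V → Set
  Positionable X u v =
    ∀ (P : Walk u v) → Shortest P →
    ∀ w → w ∈ verts P → w ∈ X → (w ≡ u ⊎ w ≡ v)

  IsTotalGP : List V → Set
  IsTotalGP X = Unique X × (∀ u v → Positionable X u v)

  IsDualGP : List V → Set
  IsDualGP X = Unique X ×
    ((∀ u v → u ∈ X → v ∈ X → Positionable X u v) ×
     (∀ u v → u ∉ X → v ∉ X → Positionable X u v))

  MaxSize : (List V → Set) → ℕ → Set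
  MaxSize P k =
    (Σ (List V) λ X → P X × length X ≡ k) ×
    (∀ X → P X → length X ≤ k)

  ExactlyOne : (List V → Set) → ℕ → Set
  ExactlyOne P k =
    (Σ (List V) λ X → P X × length X ≡ k) ×
    (∀ X Y → P X → length X ≡ k → P Y → length Y ≡ k →
       ∀ w → (w ∈ X) ⇔ (w ∈ Y))

-- Sierpiński graph S_3^n : vertices are words i_1 ... i_n over {0,1,2}

SVertex : ℕ → Set
SVertex n = Vec (Fin 3) n

SAdj : (n : ℕ) → SVertex n → SVertex n → Set
SAdj n i j = Σ (Fin n) λ h →
  (∀ t → t <ᶠ h → lookup i t ≡ lookup j t) ×
  (lookup i h ≢ lookup j h) ×
  (∀ t → h <ᶠ t → (lookup i t ≡ lookup j h) × (lookup j t ≡ lookup i h))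

module S (n : ℕ) = Graph (SVertex n) (SAdj n)

-- The extreme vertices 0ⁿ, 1ⁿ, 2ⁿ are simplicial (their two neighbours are adjacent), so no
-- shortest path passes through them: they form a total, hence also a dual, general position set.
-- Conversely let X be a dual general position set, and let δ l be the distance to lⁿ.  A path
-- along which some δ l drops by 1 at every step is a geodesic, and every non-extreme vertex x
-- is the second vertex of such a path prev–x–next–next².  Positionability along its
-- sub-geodesics shows that x ∈ X forces next ∉ X and then prev ∈ X.  Applying this at y = prev
-- and at its own predecessor p yields next₁, next₂ ∉ X with next₁–y–p–next₂ a geodesic, so
-- y ∉ X and hence x ∉ X.  Thus X ⊆ {0ⁿ, 1ⁿ, 2ⁿ}, and the claims follow by counting.

module Submission where

open import Defs
open import Data.Bool using (if_then_else_)
open import Data.Empty using (⊥; ⊥-elim)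
open import Data.Fin using (Fin; zero; suc) renaming (_<_ to _<ᶠ_)
open import Data.Fin.Properties using (_≟_)
open import Data.List using (List; []; _∷_; length)
open import Data.List.Properties using (length-removeAt′)
open import Data.List.Membership.Propositional using (_∈_; _∉_)
open import Data.List.Relation.Binary.Subset.Propositional using (_⊆_)
open import Data.List.Relation.Unary.All as All using ([]; _∷_)
open import Data.List.Relation.Unary.AllPairs using ([]; _∷_)
open import Data.List.Relation.Unary.Any using (here; there; _─_; index)
open import Data.List.Relation.Unary.Unique.Propositional using (Unique)
open import Data.Nat using (ℕ; zero; suc; _+_; _^_; _≤_; z≤n; s≤s; s≤s⁻¹)
open import Data.Nat.Properties
  using ( n≤1+n; 1+n≰n; ≤-refl; ≤-reflexive; ≤-trans; ≤-antisym; +-suc; +-identityʳ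
        ; suc-injective; m≢1+n+m; +-cancelʳ-≤; +-commutativeSemigroup; module ≤-Reasoning)
open import Algebra.Properties.CommutativeSemigroup +-commutativeSemigroup using (x∙yz≈y∙xz)
open import Data.Product using (Σ-syntax; _×_; _,_; proj₁; proj₂; swap)
open import Data.Sum using (_⊎_; inj₁; inj₂; [_,_]′)
open import Data.Vec using ([]; _∷_; lookup; replicate; _∷ʳ_; last)
open import Data.Vec.Properties using (∷-injectiveˡ; ≡-dec; lookup-replicate; last-∷ʳ)
open import Function using (_∘_)
open import Function.Bundles using (_⇔_; mk⇔)
open import Relation.Binary.Definitions using (DecidableEquality)
open import Relation.Binary.PropositionalEquality
  using (_≡_; _≢_; refl; sym; trans; cong; cong₂; subst; module ≡-Reasoning)
open import Relation.Nullary using (¬_; yes; no; does)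
open import Relation.Nullary.Decidable using (dec-true; dec-false)

module GraphProperties (V : Set) (Adj : V → V → Set) where
  open Graph V Adj

  infixr 5 _∷⟨_⟩_
  _∷⟨_⟩_ : ∀ u {w v} → Adj u w → Walk w v → Walk u v
  u ∷⟨ e ⟩ P = cons e P

  [_] : ∀ v → Walk v v
  [ v ] = nil

  Simplicial : V → Set
  Simplicial w = ∀ {p q} → Adj p w → Adj w q → p ≡ q ⊎ Adj p q

  shortcut : ∀ {w u u₁ v} → Simplicial w → Adj u u₁ → (P : Walk u₁ v) →
             w ∈ verts P → w ≢ v → Σ[ Q ∈ Walk u v ] len Q ≤ len P
  shortcut simp e nil (here refl) w≢v = ⊥-elim (w≢v refl)
  shortcut simp e (cons e′ P) (here refl) w≢v with simp e e′
  ... | inj₁ refl = P , n≤1+n (len P)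
  ... | inj₂ e″   = cons e″ P , ≤-refl
  shortcut simp e (cons e′ P) (there w∈P) w≢v =
    let Q , Q≤P = shortcut simp e′ P w∈P w≢v in cons e Q , s≤s Q≤P

  simplicial-¬interior : ∀ {w u v} → Simplicial w → (P : Walk u v) → Shortest P →
                         w ∈ verts P → w ≢ u → w ≢ v → ⊥
  simplicial-¬interior simp nil        _        (here w≡u)  w≢u _   = w≢u w≡u
  simplicial-¬interior simp (cons e P) _        (here w≡u)  w≢u _   = w≢u w≡u
  simplicial-¬interior simp (cons e P) shortest (there w∈P) _   w≢v =
    let Q , Q≤P = shortcut simp e P w∈P w≢v in 1+n≰n (≤-trans (shortest Q) Q≤P)

  simplicial-positionable : DecidableEquality V → ∀ {X} → (∀ {w} → w ∈ X → Simplicial w) →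
                            ∀ u v → Positionable X u v
  simplicial-positionable _≟ᵥ_ simp u v P shortest w w∈P w∈X with w ≟ᵥ u | w ≟ᵥ v
  ... | yes w≡u | _       = inj₁ w≡u
  ... | no _    | yes w≡v = inj₂ w≡v
  ... | no w≢u  | no w≢v  = ⊥-elim (simplicial-¬interior (simp w∈X) P shortest w∈P w≢u w≢v)

  second≢source : ∀ {u w x v} (e : Adj u w) (e′ : Adj w x) (P : Walk x v) →
                  Shortest (cons e (cons e′ P)) → w ≢ u
  second≢source e e′ P shortest refl = 1+n≰n (shortest (cons e′ P))

  second≢target : ∀ {u w x v} (e : Adj u w) (e′ : Adj w x) (P : Walk x v) →
                  Shortest (cons e (cons e′ P)) → w ≢ v
  second≢target e e′ P shortest refl with shortest (cons e nil)
  ... | s≤s ()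

  positionable⇒second∉ : ∀ {X u w x v} → Positionable X u v →
                         (e : Adj u w) (e′ : Adj w x) (P : Walk x v) →
                         Shortest (cons e (cons e′ P)) → w ∉ X
  positionable⇒second∉ pos e e′ P shortest w∈X =
    [ second≢source e e′ P shortest , second≢target e e′ P shortest ]′
      (pos (cons e (cons e′ P)) shortest _ (there (here refl)) w∈X)

module _ {A : Set} where

  ∈-─ : ∀ {x z} {ys : List A} (x∈ys : x ∈ ys) → z ∈ ys → z ≢ x → z ∈ (ys ─ x∈ys)
  ∈-─ (here refl)  (here refl)  z≢x = ⊥-elim (z≢x refl)
  ∈-─ (here refl)  (there z∈ys) _   = z∈ys
  ∈-─ (there _)    (here refl)  _   = here refl
  ∈-─ (there x∈ys) (there z∈ys) z≢x = there (∈-─ x∈ys z∈ys z≢x)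

  ⊆-─ : ∀ {x} {xs ys : List A} → xs ⊆ ys → x ∉ xs → (x∈ys : x ∈ ys) →
        xs ⊆ (ys ─ x∈ys)
  ⊆-─ xs⊆ys x∉xs x∈ys z∈xs = ∈-─ x∈ys (xs⊆ys z∈xs) λ { refl → x∉xs z∈xs }

  Unique∧⊆⇒length≤ : ∀ {xs ys : List A} → Unique xs → xs ⊆ ys → length xs ≤ length ys
  Unique∧⊆⇒length≤ [] _ = z≤n
  Unique∧⊆⇒length≤ {x ∷ xs} {ys} (x≢xs ∷ unique) xs⊆ys = begin
    suc (length xs)          ≤⟨ s≤s (Unique∧⊆⇒length≤ unique (⊆-─ (xs⊆ys ∘ there) x∉xs x∈ys)) ⟩
    suc (length (ys ─ x∈ys)) ≡⟨ length-removeAt′ ys (index x∈ys) ⟨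
    length ys                ∎
    where
    open ≤-Reasoning
    x∈ys : x ∈ ys
    x∈ys = xs⊆ys (here refl)
    x∉xs : x ∉ xs
    x∉xs x∈xs = All.lookup x≢xs x∈xs refl

  module _ (_≟ₐ_ : DecidableEquality A) where
    open import Data.List.Membership.DecPropositional _≟ₐ_ using (_∈?_)

    Unique∧⊆∧length≥⇒⊇ : ∀ {xs ys : List A} → Unique xs → xs ⊆ ys →
                          length ys ≤ length xs → ys ⊆ xs
    Unique∧⊆∧length≥⇒⊇ {xs} {ys} unique xs⊆ys ys≤xs {y} y∈ys with y ∈? xs
    ... | yes y∈xs = y∈xs
    ... | no  y∉xs = ⊥-elim (1+n≰n (begin
      suc (length xs)          ≤⟨ s≤s (Unique∧⊆⇒length≤ unique (⊆-─ xs⊆ys y∉xs y∈ys)) ⟩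
      suc (length (ys ─ y∈ys)) ≡⟨ length-removeAt′ ys (index y∈ys) ⟨
      length ys                ≤⟨ ys≤xs ⟩
      length xs                ∎))
      where open ≤-Reasoning

private variable
  m n : ℕ

adj-0 : {u w : SVertex 0} → ¬ SAdj 0 u w
adj-0 (() , _)

adj-sym : {u w : SVertex n} → SAdj n u w → SAdj n w u
adj-sym (h , before , differ , after) =
  h , (λ t t<h → sym (before t t<h)) , differ ∘ sym , (λ t h<t → swap (after t h<t))

adj-∷⁺ : ∀ y {u w : SVertex n} → SAdj n u w → SAdj (suc n) (y ∷ u) (y ∷ w)
adj-∷⁺ y {u} {w} (h , before , differ , after) = suc h , before′ , differ , after′
  where
  before′ : ∀ t → t <ᶠ suc h → lookup (y ∷ u) t ≡ lookup (y ∷ w) t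
  before′ zero    _         = refl
  before′ (suc t) (s≤s t<h) = before t t<h
  after′ : ∀ t → suc h <ᶠ t → (lookup (y ∷ u) t ≡ lookup w h) × (lookup (y ∷ w) t ≡ lookup u h)
  after′ (suc t) (s≤s h<t) = after t h<t

bridge : ∀ {i j} → i ≢ j → SAdj (suc n) (i ∷ replicate n j) (j ∷ replicate n i)
bridge {n} {i} {j} i≢j = zero , (λ _ ()) , i≢j , after
  where
  after : ∀ (t : Fin (suc n)) → zero {n} <ᶠ t →
          (lookup (i ∷ replicate n j) t ≡ j) × (lookup (j ∷ replicate n i) t ≡ i)
  after (suc t) _ = lookup-replicate t j , lookup-replicate t i

replicate-from-lookup : ∀ (s : SVertex n) l → (∀ t → lookup s t ≡ l) → s ≡ replicate n l
replicate-from-lookup []      l _      = refl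
replicate-from-lookup (y ∷ s) l lookup≡l =
  cong₂ _∷_ (lookup≡l zero) (replicate-from-lookup s l (lookup≡l ∘ suc))

adj-∷⁻ : ∀ {a b} {s t : SVertex n} → SAdj (suc n) (a ∷ s) (b ∷ t) →
         (a ≡ b × SAdj n s t) ⊎ (a ≢ b × s ≡ replicate n b × t ≡ replicate n a)
adj-∷⁻ {s = s} {t} (zero , _ , a≢b , after) =
  inj₂ (a≢b , replicate-from-lookup s _ (λ t′ → proj₁ (after (suc t′) (s≤s z≤n)))
            , replicate-from-lookup t _ (λ t′ → proj₂ (after (suc t′) (s≤s z≤n))))
adj-∷⁻ (suc h , before , differ , after) =
  inj₁ (before zero (s≤s z≤n) , h , (λ t t<h → before (suc t) (s≤s t<h)) , differ
                              , (λ t h<t → after (suc t) (s≤s h<t)))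

∷ʳ-adj : ∀ (s : SVertex n) {z z′} → z ≢ z′ → SAdj (suc n) (s ∷ʳ z) (s ∷ʳ z′)
∷ʳ-adj []      z≢z′ = bridge z≢z′
∷ʳ-adj (y ∷ s) z≢z′ = adj-∷⁺ y (∷ʳ-adj s z≢z′)

replicate-∷ʳ : ∀ n (y : Fin 3) → replicate (suc n) y ≡ replicate n y ∷ʳ y
replicate-∷ʳ zero    y = refl
replicate-∷ʳ (suc n) y = cong (y ∷_) (replicate-∷ʳ n y)

replicate-∷ʳ-adj : ∀ {y z} → z ≢ y → SAdj (suc n) (replicate n y ∷ʳ z) (replicate (suc n) y)
replicate-∷ʳ-adj {n} {y} {z} z≢y =
  subst (SAdj (suc n) (replicate n y ∷ʳ z)) (sym (replicate-∷ʳ n y)) (∷ʳ-adj (replicate n y) z≢y)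

module SP (n : ℕ) = GraphProperties (SVertex n) (SAdj n)

replicate-nbr : ∀ {l} {p : SVertex (suc n)} → SAdj (suc n) (replicate (suc n) l) p →
                Σ[ z ∈ Fin 3 ] p ≡ replicate n l ∷ʳ z
replicate-nbr {zero}      {p = z ∷ []} _ = z , refl
replicate-nbr {suc n} {l} {p = y ∷ s}  e with adj-∷⁻ e
... | inj₁ (refl , e′)       = let z , s≡ = replicate-nbr e′ in z , cong (l ∷_) s≡
... | inj₂ (l≢y , l*≡y* , _) = ⊥-elim (l≢y (∷-injectiveˡ l*≡y*))

replicate-simplicial : ∀ n l → SP.Simplicial n (replicate n l)
replicate-simplicial zero    l {p} e _ = ⊥-elim (adj-0 {u = p} {[]} e)
replicate-simplicial (suc n) l {p} {q} e₁ e₂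
  with replicate-nbr {n} {l} {p} (adj-sym {u = p} {replicate (suc n) l} e₁)
     | replicate-nbr {n} {l} {q} e₂
... | z , refl | z′ , refl with z ≟ z′
...   | yes refl = inj₁ refl
...   | no z≢z′  = inj₂ (∷ʳ-adj (replicate n l) z≢z′)

Extreme : SVertex n → Set
Extreme {n} x = Σ[ l ∈ Fin 3 ] x ≡ replicate n l

-- δ l x is the distance from x to lⁿ: a letter other than l followed by n letters costs 2ⁿ.
cost : ℕ → Fin 3 → Fin 3 → ℕ
cost n y l = if does (y ≟ l) then 0 else 2 ^ n

δ : Fin 3 → SVertex n → ℕ
δ         l []      = 0
δ {suc n} l (y ∷ s) = cost n y l + δ l s

δ-∷-≡ : ∀ l (s : SVertex n) → δ l (l ∷ s) ≡ δ l s
δ-∷-≡ l s rewrite dec-true (l ≟ l) refl = refl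

δ-∷-≢ : ∀ {y l} → y ≢ l → (s : SVertex n) → δ l (y ∷ s) ≡ 2 ^ n + δ l s
δ-∷-≢ {y = y} {l} y≢l s rewrite dec-false (y ≟ l) y≢l = refl

δ-gap-∷ : ∀ {l d} y (u w : SVertex n) → δ l u ≡ d + δ l w → δ l (y ∷ u) ≡ d + δ l (y ∷ w)
δ-gap-∷ {n} {l} {d} y u w eq = trans (cong (cost n y l +_) eq) (x∙yz≈y∙xz (cost n y l) d (δ l w))

δ-replicate : ∀ n l → δ l (replicate n l) ≡ 0
δ-replicate zero    l = refl
δ-replicate (suc n) l = trans (δ-∷-≡ l (replicate n l)) (δ-replicate n l)

δ-replicate-≢ : ∀ n {z l} → z ≢ l → 1 + δ l (replicate n z) ≡ 2 ^ n
δ-replicate-≢ zero    z≢l = refl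
δ-replicate-≢ (suc n) {z} {l} z≢l = begin
  1 + δ l (z ∷ replicate n z)    ≡⟨ cong suc (δ-∷-≢ z≢l (replicate n z)) ⟩
  1 + (2 ^ n + δ l (replicate n z)) ≡⟨ +-suc (2 ^ n) _ ⟨
  2 ^ n + (1 + δ l (replicate n z)) ≡⟨ cong (2 ^ n +_) (δ-replicate-≢ n z≢l) ⟩
  2 ^ n + 2 ^ n                  ≡⟨ cong (2 ^ n +_) (+-identityʳ (2 ^ n)) ⟨
  2 ^ suc n                      ∎
  where open ≡-Reasoning

δ-bridge : ∀ {i j} → i ≢ j → δ j (i ∷ replicate n j) ≡ 1 + δ j (j ∷ replicate n i)
δ-bridge {n} {i} {j} i≢j = begin
  δ j (i ∷ replicate n j)     ≡⟨ δ-∷-≢ i≢j (replicate n j) ⟩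
  2 ^ n + δ j (replicate n j) ≡⟨ cong (2 ^ n +_) (δ-replicate n j) ⟩
  2 ^ n + 0                   ≡⟨ +-identityʳ (2 ^ n) ⟩
  2 ^ n                       ≡⟨ δ-replicate-≢ n i≢j ⟨
  1 + δ j (replicate n i)     ≡⟨ cong suc (δ-∷-≡ j (replicate n i)) ⟨
  1 + δ j (j ∷ replicate n i) ∎
  where open ≡-Reasoning

δ-singleton-≢ : ∀ {y l} → y ≢ l → δ l (y ∷ []) ≡ 1 + δ l (l ∷ [])
δ-singleton-≢ {l = l} y≢l = trans (δ-∷-≢ y≢l []) (cong suc (sym (δ-∷-≡ l [])))

δ-replicate-∷ʳ-away : ∀ m {l z} → z ≢ l →
                      δ l (replicate m l ∷ʳ z) ≡ 1 + δ l (replicate (suc m) l)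
δ-replicate-∷ʳ-away zero        z≢l = δ-singleton-≢ z≢l
δ-replicate-∷ʳ-away (suc m) {l} {z} z≢l =
  δ-gap-∷ {d = 1} l (replicate m l ∷ʳ z) (replicate (suc m) l) (δ-replicate-∷ʳ-away m z≢l)

δ-replicate-∷ʳ-toward : ∀ m {i j} → i ≢ j →
                        δ j (replicate (suc m) i) ≡ 1 + δ j (replicate m i ∷ʳ j)
δ-replicate-∷ʳ-toward zero        i≢j = δ-singleton-≢ i≢j
δ-replicate-∷ʳ-toward (suc m) {i} {j} i≢j =
  δ-gap-∷ {d = 1} i (replicate (suc m) i) (replicate m i ∷ʳ j) (δ-replicate-∷ʳ-toward m i≢j)

record Shift (u w : SVertex (suc n)) : Set where
  field
    away toward : Fin 3
    δ-away      : δ away w ≡ 1 + δ away u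
    δ-toward    : δ toward u ≡ 1 + δ toward w
    δ-other     : ∀ l → l ≢ away → l ≢ toward → δ l w ≡ δ l u
    last-source : last u ≡ away ⊎ last u ≡ toward

shift-∷ : ∀ y {s t : SVertex (suc n)} → Shift s t → Shift (y ∷ s) (y ∷ t)
shift-∷ y {s} {t} sh = record
  { away        = away
  ; toward      = toward
  ; δ-away      = δ-gap-∷ y t s δ-away
  ; δ-toward    = δ-gap-∷ y s t δ-toward
  ; δ-other     = λ l l≢a l≢t → δ-gap-∷ {d = 0} y t s (δ-other l l≢a l≢t)
  ; last-source = last-source
  }
  where open Shift sh

shift-bridge : ∀ {y y′} → y ≢ y′ → Shift (y ∷ replicate n y′) (y′ ∷ replicate n y)
shift-bridge {n} {y} {y′} y≢y′ = record
  { away        = y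
  ; toward      = y′
  ; δ-away      = δ-bridge {n} (y≢y′ ∘ sym)
  ; δ-toward    = δ-bridge {n} y≢y′
  ; δ-other     = other
  ; last-source = last-bridge n
  }
  where
  other : ∀ l → l ≢ y → l ≢ y′ → δ l (y′ ∷ replicate n y) ≡ δ l (y ∷ replicate n y′)
  other l l≢y l≢y′ = begin
    δ l (y′ ∷ replicate n y)     ≡⟨ δ-∷-≢ (l≢y′ ∘ sym) (replicate n y) ⟩
    2 ^ n + δ l (replicate n y)  ≡⟨ cong (2 ^ n +_) (suc-injective (trans
                                      (δ-replicate-≢ n (l≢y ∘ sym))
                                      (sym (δ-replicate-≢ n (l≢y′ ∘ sym))))) ⟩
    2 ^ n + δ l (replicate n y′) ≡⟨ δ-∷-≢ (l≢y ∘ sym) (replicate n y′) ⟨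
    δ l (y ∷ replicate n y′)     ∎
    where open ≡-Reasoning
  last-bridge : ∀ n → last (y ∷ replicate n y′) ≡ y ⊎ last (y ∷ replicate n y′) ≡ y′
  last-bridge zero    = inj₁ refl
  last-bridge (suc n) = inj₂ (trans (cong last (replicate-∷ʳ n y′)) (last-∷ʳ y′ (replicate n y′)))

shift : ∀ {u w : SVertex (suc n)} → SAdj (suc n) u w → Shift u w
shift {zero} {y ∷ []} {y′ ∷ []} e with adj-∷⁻ e
... | inj₁ (_ , e′)            = ⊥-elim (adj-0 {u = []} {[]} e′)
... | inj₂ (y≢y′ , refl , refl) = shift-bridge y≢y′
shift {suc n} {y ∷ s} {y′ ∷ s′} e with adj-∷⁻ e
... | inj₁ (refl , e′)          = shift-∷ y (shift e′)
... | inj₂ (y≢y′ , refl , refl) = shift-bridge y≢y′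

module _ {u w : SVertex (suc n)} (sh : Shift u w) where
  open Shift sh

  shift-lipschitz : ∀ l → δ l w ≤ 1 + δ l u
  shift-lipschitz l with l ≟ away | l ≟ toward
  ... | yes refl | _        = ≤-reflexive δ-away
  ... | no _     | yes refl =
    ≤-trans (n≤1+n (δ l w)) (≤-trans (≤-reflexive (sym δ-toward)) (n≤1+n (δ l u)))
  ... | no l≢a   | no l≢t   = ≤-trans (≤-reflexive (δ-other l l≢a l≢t)) (n≤1+n (δ l u))

  rises⇒away : ∀ l → δ l w ≡ 1 + δ l u → l ≡ away
  rises⇒away l rise with l ≟ away | l ≟ toward
  ... | yes l≡a  | _        = l≡a
  ... | no _     | yes refl = ⊥-elim (m≢1+n+m (δ l w) {1} (trans rise (cong suc δ-toward)))
  ... | no l≢a   | no l≢t   = ⊥-elim (m≢1+n+m (δ l u) {0} (trans (sym (δ-other l l≢a l≢t)) rise))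

  falls⇒toward : ∀ l → δ l u ≡ 1 + δ l w → l ≡ toward
  falls⇒toward l fall with l ≟ toward | l ≟ away
  ... | yes l≡t  | _        = l≡t
  ... | no _     | yes refl = ⊥-elim (m≢1+n+m (δ l u) {1} (trans fall (cong suc δ-away)))
  ... | no l≢t   | no l≢a   =
    ⊥-elim (m≢1+n+m (δ l u) {0} (trans fall (cong suc (δ-other l l≢a l≢t))))

δ-lipschitz : ∀ l {u w : SVertex n} → SAdj n u w → δ l w ≤ 1 + δ l u
δ-lipschitz {zero}  l {u} {w} e = ⊥-elim (adj-0 {u = u} {w} e)
δ-lipschitz {suc n} l {u} {w} e = shift-lipschitz (shift {u = u} {w} e) l

δ-rise-2 : ∀ l {u w v : SVertex n} → SAdj n u w → SAdj n w v →
           δ l v ≡ 2 + δ l u → δ l w ≡ 1 + δ l u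
δ-rise-2 l {u} {w} {v} e e′ rise =
  ≤-antisym (δ-lipschitz l {u} {w} e)
            (s≤s⁻¹ (subst (_≤ 1 + δ l w) rise (δ-lipschitz l {w} {v} e′)))

-- The first edge of a path u w v would have to raise δ k and lower δ t, so its source u would
-- end in k or t.
δ-separated⇒¬2-path : ∀ {k t} {u w v : SVertex (suc n)} →
                      δ k v ≡ 2 + δ k u → δ t u ≡ 2 + δ t v → last u ≢ k → last u ≢ t →
                      SAdj (suc n) u w → SAdj (suc n) w v → ⊥
δ-separated⇒¬2-path {k = k} {t} {u} {w} {v} k-rises t-falls last≢k last≢t e e′ =
  [ (λ last≡away → last≢k (trans last≡away (sym k≡away)))
  , (λ last≡toward → last≢t (trans last≡toward (sym t≡toward))) ]′ last-source
  where
  sh : Shift u w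
  sh = shift {u = u} {w} e
  open Shift sh
  k≡away : k ≡ away
  k≡away = rises⇒away sh k (δ-rise-2 k {u} {w} {v} e e′ k-rises)
  t≡toward : t ≡ toward
  t≡toward = falls⇒toward sh t (trans t-falls (cong suc (sym
    (δ-rise-2 t {v} {w} {u} (adj-sym {u = w} {v} e′) (adj-sym {u = u} {w} e) t-falls))))

module _ {n : ℕ} where
  open S n

  δ-≤-len+δ : ∀ l {u v} (P : Walk u v) → δ l u ≤ len P + δ l v
  δ-≤-len+δ l nil                    = ≤-refl
  δ-≤-len+δ l {u} (cons {w = w} e P) =
    ≤-trans (δ-lipschitz l {w} {u} (adj-sym {u = u} {w} e)) (s≤s (δ-≤-len+δ l P))

  δ-gap≤len : ∀ l {u v d} (P : Walk u v) → δ l u ≡ d + δ l v → d ≤ len P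
  δ-gap≤len l {v = v} {d} P gap =
    +-cancelʳ-≤ (δ l v) d (len P) (subst (_≤ len P + δ l v) gap (δ-≤-len+δ l P))

  δ-gap⇒shortest : ∀ l {u v} (P : Walk u v) → δ l u ≡ len P + δ l v → Shortest P
  δ-gap⇒shortest l P gap Q = δ-gap≤len l Q gap

δ-separated⇒3≤len : ∀ {k t} {u v : SVertex (suc n)} → δ k v ≡ 2 + δ k u → δ t u ≡ 2 + δ t v →
                    last u ≢ k → last u ≢ t → (Q : S.Walk (suc n) u v) → 3 ≤ S.len (suc n) Q
δ-separated⇒3≤len {t = t} {u} _ t-falls _ _ S.nil with δ-gap≤len t {u} {u} {2} S.nil t-falls
... | ()
δ-separated⇒3≤len {t = t} {u} {v} _ t-falls _ _ (S.cons e S.nil)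
  with δ-gap≤len t {u} {v} {2} (S.cons e S.nil) t-falls
... | s≤s ()
δ-separated⇒3≤len {u = u} {v} k-rises t-falls last≢k last≢t (S.cons {w = w} e (S.cons e′ S.nil)) =
  ⊥-elim (δ-separated⇒¬2-path {u = u} {w} {v} k-rises t-falls last≢k last≢t e e′)
δ-separated⇒3≤len _ _ _ _ (S.cons _ (S.cons _ (S.cons _ _))) = s≤s (s≤s (s≤s z≤n))

third-letter : ∀ i j → Σ[ k ∈ Fin 3 ] k ≢ i × k ≢ j
third-letter zero             zero             = suc zero , (λ ()) , (λ ())
third-letter zero             (suc zero)       = suc (suc zero) , (λ ()) , (λ ())
third-letter zero             (suc (suc zero)) = suc zero , (λ ()) , (λ ())
third-letter (suc zero)       zero             = suc (suc zero) , (λ ()) , (λ ())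
third-letter (suc zero)       (suc zero)       = zero , (λ ()) , (λ ())
third-letter (suc zero)       (suc (suc zero)) = zero , (λ ()) , (λ ())
third-letter (suc (suc zero)) zero             = suc zero , (λ ()) , (λ ())
third-letter (suc (suc zero)) (suc zero)       = zero , (λ ()) , (λ ())
third-letter (suc (suc zero)) (suc (suc zero)) = zero , (λ ()) , (λ ())

record Descent {n : ℕ} (x : SVertex n) : Set where
  field
    target          : Fin 3
    prev next next² : SVertex n
    prev~x          : SAdj n prev x
    x~next          : SAdj n x next
    next~next²      : SAdj n next next²
    δ-prev          : δ target prev ≡ 1 + δ target x
    δ-x             : δ target x ≡ 1 + δ target next
    δ-next          : δ target next ≡ 1 + δ target next²

  open S n using (Walk; Shortest)
  open SP n using (_∷⟨_⟩_; [_])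

  prev⇝next : Walk prev next
  prev⇝next = prev ∷⟨ prev~x ⟩ x ∷⟨ x~next ⟩ [ next ]

  x⇝next² : Walk x next²
  x⇝next² = x ∷⟨ x~next ⟩ next ∷⟨ next~next² ⟩ [ next² ]

  prev⇝next² : Walk prev next²
  prev⇝next² = prev ∷⟨ prev~x ⟩ x⇝next²

  prev⇝next-shortest : Shortest prev⇝next
  prev⇝next-shortest = δ-gap⇒shortest target prev⇝next (trans δ-prev (cong suc δ-x))

  x⇝next²-shortest : Shortest x⇝next²
  x⇝next²-shortest = δ-gap⇒shortest target x⇝next² (trans δ-x (cong suc δ-next))

  prev⇝next²-shortest : Shortest prev⇝next²
  prev⇝next²-shortest =
    δ-gap⇒shortest target prev⇝next² (trans δ-prev (cong suc (trans δ-x (cong suc δ-next))))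

descent-∷ : ∀ y {x : SVertex n} → Descent x → Descent (y ∷ x)
descent-∷ y {x} D = record
  { target     = target
  ; prev       = y ∷ prev
  ; next       = y ∷ next
  ; next²      = y ∷ next²
  ; prev~x     = adj-∷⁺ y prev~x
  ; x~next     = adj-∷⁺ y x~next
  ; next~next² = adj-∷⁺ y next~next²
  ; δ-prev     = δ-gap-∷ y prev x δ-prev
  ; δ-x        = δ-gap-∷ y x next δ-x
  ; δ-next     = δ-gap-∷ y next next² δ-next
  }
  where open Descent D

descent-base : ∀ m {i j k} → i ≢ j → k ≢ j → Descent (i ∷ replicate (suc m) j)
descent-base m {i} {j} {k} i≢j k≢j = record
  { target     = j
  ; prev       = i ∷ (replicate m j ∷ʳ k)
  ; next       = j ∷ replicate (suc m) i
  ; next²      = j ∷ (replicate m i ∷ʳ j)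
  ; prev~x     = adj-∷⁺ i (replicate-∷ʳ-adj k≢j)
  ; x~next     = bridge i≢j
  ; next~next² = adj-∷⁺ j (adj-sym {u = replicate m i ∷ʳ j} {replicate (suc m) i}
                                   (replicate-∷ʳ-adj (i≢j ∘ sym)))
  ; δ-prev     = δ-gap-∷ {d = 1} i (replicate m j ∷ʳ k) (replicate (suc m) j)
                                   (δ-replicate-∷ʳ-away m k≢j)
  ; δ-x        = δ-bridge {suc m} i≢j
  ; δ-next     = δ-gap-∷ {d = 1} j (replicate (suc m) i) (replicate m i ∷ʳ j)
                                   (δ-replicate-∷ʳ-toward m i≢j)
  }

record Obstruction {n : ℕ} (y : SVertex (suc n)) : Set where
  field
    first     : Descent y
    second    : Descent (Descent.prev first)
    up down   : Fin 3
    δ-up      : δ up (Descent.next second) ≡ 2 + δ up (Descent.next first)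
    δ-down    : δ down (Descent.next first) ≡ 2 + δ down (Descent.next second)
    last≢up   : last (Descent.next first) ≢ up
    last≢down : last (Descent.next first) ≢ down

  open S (suc n) using (Shortest)
  open SP (suc n) using (_∷⟨_⟩_; [_])
  open Descent

  detour-shortest : Shortest (next first ∷⟨ adj-sym {u = y} {next first} (x~next first) ⟩
                              y          ∷⟨ adj-sym {u = prev first} {y} (prev~x first) ⟩
                              prev first ∷⟨ x~next second ⟩
                              [ next second ])
  detour-shortest Q = δ-separated⇒3≤len δ-up δ-down last≢up last≢down Q

obstruction-∷ : ∀ l {y : SVertex (suc n)} → Obstruction y → Obstruction (l ∷ y)
obstruction-∷ l O = record
  { first     = descent-∷ l first
  ; second    = descent-∷ l second
  ; up        = up
  ; down      = down
  ; δ-up      = δ-gap-∷ l (next second) (next first) δ-up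
  ; δ-down    = δ-gap-∷ l (next first) (next second) δ-down
  ; last≢up   = last≢up
  ; last≢down = last≢down
  }
  where
  open Obstruction O
  open Descent

obstruction-pair : ∀ {r k t} → r ≢ k → t ≢ r → t ≢ k → Obstruction (r ∷ k ∷ [])
obstruction-pair {r} {k} {t} r≢k t≢r t≢k = record
  { first     = descent-base 0 r≢k t≢k
  ; second    = descent-base 0 (t≢r ∘ sym) (t≢k ∘ sym)
  ; up        = k
  ; down      = t
  ; δ-up      = trans (δ-∷-≢ t≢k (r ∷ [])) (cong (2 +_) (sym (δ-∷-≡ k (r ∷ []))))
  ; δ-down    = trans (δ-∷-≢ (t≢k ∘ sym) (r ∷ [])) (cong (2 +_) (sym (δ-∷-≡ t (r ∷ []))))
  ; last≢up   = r≢k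
  ; last≢down = t≢r ∘ sym
  }

obstruction : ∀ m {y z k} → y ≢ k → z ≢ k → Obstruction (y ∷ (replicate m z ∷ʳ k))
obstruction zero    {y} {k = k} y≢k _   =
  let t , t≢y , t≢k = third-letter y k in obstruction-pair y≢k t≢y t≢k
obstruction (suc m) {y}         y≢k z≢k = obstruction-∷ y (obstruction m z≢k z≢k)

Excluded : SVertex (suc n) → Set
Excluded x = Σ[ D ∈ Descent x ] Obstruction (Descent.prev D)

excluded-base : ∀ m {i j} → i ≢ j → Excluded (i ∷ replicate (suc m) j)
excluded-base m {i} {j} i≢j =
  let k , k≢i , k≢j = third-letter i j in
  descent-base m i≢j k≢j , obstruction m (k≢i ∘ sym) (k≢j ∘ sym)

extreme-or-excluded : ∀ (x : SVertex (suc n)) → Extreme x ⊎ Excluded x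
extreme-or-excluded {zero}  (y ∷ []) = inj₁ (y , refl)
extreme-or-excluded {suc n} (y ∷ s) with extreme-or-excluded s
... | inj₂ (D , O) = inj₂ (descent-∷ y D , obstruction-∷ y O)
... | inj₁ (l , refl) with y ≟ l
...   | yes refl = inj₁ (l , refl)
...   | no  y≢l  = inj₂ (excluded-base n y≢l)

module DualGP {m : ℕ} {X : List (SVertex (suc m))} (dual : S.IsDualGP (suc m) X) where
  open SP (suc m) using (_∷⟨_⟩_; [_]; positionable⇒second∉)

  private
    inside : ∀ u v → u ∈ X → v ∈ X → S.Positionable (suc m) X u v
    inside = proj₁ (proj₂ dual)
    outside : ∀ u v → u ∉ X → v ∉ X → S.Positionable (suc m) X u v
    outside = proj₂ (proj₂ dual)

  descent-next∉ : ∀ {x} (D : Descent x) → x ∈ X → Descent.next D ∉ X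
  descent-next∉ {x} D x∈X next∈X =
    positionable⇒second∉ (outside prev next² prev∉X next²∉X)
      prev~x x~next (next ∷⟨ next~next² ⟩ [ next² ]) prev⇝next²-shortest x∈X
    where
    open Descent D
    prev∉X : prev ∉ X
    prev∉X prev∈X =
      positionable⇒second∉ (inside prev next prev∈X next∈X)
        prev~x x~next [ next ] prev⇝next-shortest x∈X
    next²∉X : next² ∉ X
    next²∉X next²∈X =
      positionable⇒second∉ (inside x next² x∈X next²∈X)
        x~next next~next² [ next² ] x⇝next²-shortest next∈X

  descent-prev∉ : ∀ {x} (D : Descent x) → Descent.prev D ∉ X → x ∉ X
  descent-prev∉ D prev∉X x∈X =
    positionable⇒second∉ (outside prev next prev∉X (descent-next∉ D x∈X))
      prev~x x~next [ next ] prev⇝next-shortest x∈X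
    where open Descent D

  obstruction∉ : ∀ {y} → Obstruction y → y ∉ X
  obstruction∉ {y} O y∈X = descent-prev∉ first prev₁∉X y∈X
    where
    open Obstruction O
    open Descent
    prev₁∉X : prev first ∉ X
    prev₁∉X prev₁∈X =
      positionable⇒second∉
        (outside (next first) (next second) (descent-next∉ first y∈X) (descent-next∉ second prev₁∈X))
        (adj-sym {u = y} {next first} (x~next first)) (adj-sym {u = prev first} {y} (prev~x first))
        (prev first ∷⟨ x~next second ⟩ [ next second ]) detour-shortest y∈X

  excluded∉ : ∀ {x} → Excluded x → x ∉ X
  excluded∉ (D , O) = descent-prev∉ D (obstruction∉ O)

extremes : ∀ n → List (SVertex n)
extremes n = replicate n zero ∷ replicate n (suc zero) ∷ replicate n (suc (suc zero)) ∷ []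

replicate∈extremes : ∀ n l → replicate n l ∈ extremes n
replicate∈extremes n zero             = here refl
replicate∈extremes n (suc zero)       = there (here refl)
replicate∈extremes n (suc (suc zero)) = there (there (here refl))

extremes-unique : ∀ m → Unique (extremes (suc m))
extremes-unique m = ((λ ()) ∷ (λ ()) ∷ []) ∷ ((λ ()) ∷ []) ∷ [] ∷ []

extremes-totalGP : ∀ n → S.IsTotalGP (suc n) (extremes (suc n))
extremes-totalGP n =
  extremes-unique n , SP.simplicial-positionable (suc n) (≡-dec _≟_) simplicial
  where
  simplicial : ∀ {w} → w ∈ extremes (suc n) → SP.Simplicial (suc n) w
  simplicial (here refl)                 = replicate-simplicial (suc n) zero
  simplicial (there (here refl))         = replicate-simplicial (suc n) (suc zero)
  simplicial (there (there (here refl))) = replicate-simplicial (suc n) (suc (suc zero))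

totalGP⇒dualGP : ∀ {n X} → S.IsTotalGP n X → S.IsDualGP n X
totalGP⇒dualGP (unique , positionable) =
  unique , (λ u v _ _ → positionable u v) , (λ u v _ _ → positionable u v)

module _ {m : ℕ} {X : List (SVertex (suc m))} (dual : S.IsDualGP (suc m) X) where

  dualGP⊆extremes : X ⊆ extremes (suc m)
  dualGP⊆extremes {x} x∈X with extreme-or-excluded x
  ... | inj₁ (l , refl) = replicate∈extremes (suc m) l
  ... | inj₂ excluded   = ⊥-elim (DualGP.excluded∉ dual excluded x∈X)

  dualGP-length≤3 : length X ≤ 3
  dualGP-length≤3 = Unique∧⊆⇒length≤ (proj₁ dual) dualGP⊆extremes

  extremes⊆dualGP : length X ≡ 3 → extremes (suc m) ⊆ X
  extremes⊆dualGP |X|≡3 =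
    Unique∧⊆∧length≥⇒⊇ (≡-dec _≟_) (proj₁ dual) dualGP⊆extremes (≤-reflexive (sym |X|≡3))

dualGP₃-same-elements : ∀ {m} {X Y : List (SVertex (suc m))} →
                        S.IsDualGP (suc m) X → length X ≡ 3 → S.IsDualGP (suc m) Y → length Y ≡ 3 →
                        ∀ w → (w ∈ X) ⇔ (w ∈ Y)
dualGP₃-same-elements dX |X|≡3 dY |Y|≡3 w =
  mk⇔ (extremes⊆dualGP dY |Y|≡3 ∘ dualGP⊆extremes dX)
      (extremes⊆dualGP dX |X|≡3 ∘ dualGP⊆extremes dY)

corollary4p2 : (n : ℕ) → 1 ≤ n →
    S.MaxSize n (S.IsTotalGP n) 3 × S.MaxSize n (S.IsDualGP n) 3 ×
    S.ExactlyOne n (S.IsTotalGP n) 3 × S.ExactlyOne n (S.IsDualGP n) 3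
corollary4p2 (suc m) _ =
  (total-witness , λ _ → dualGP-length≤3 ∘ totalGP⇒dualGP) ,
  (dual-witness  , λ _ → dualGP-length≤3) ,
  (total-witness , λ _ _ tX |X| tY |Y| →
                     dualGP₃-same-elements (totalGP⇒dualGP tX) |X| (totalGP⇒dualGP tY) |Y|) ,
  (dual-witness  , λ _ _ → dualGP₃-same-elements)
  where
  total-witness : Σ[ X ∈ List (SVertex (suc m)) ] S.IsTotalGP (suc m) X × length X ≡ 3
  total-witness = extremes (suc m) , extremes-totalGP m , refl
  dual-witness : Σ[ X ∈ List (SVertex (suc m)) ] S.IsDualGP (suc m) X × length X ≡ 3
  dual-witness = extremes (suc m) , totalGP⇒dualGP (extremes-totalGP m) , refl
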